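{- Let $\beta$ be a real root of an irreducible polynomial $Ax^2 + Bx + C$ with $A, B, C \in \mathbb{Z}$. If $A > 0$, $C > 0$, $B < 0$, $2A + B > 0$ and $A + B + C > 0$, then there exists $\alpha \in \mathbb{R}$ such that $p_\beta(\alpha) = \infty$.
   Context: For $\beta, \alpha \in \mathbb{C}$, $p_\beta(\alpha) \in \mathbb{Z}_{\geq 0}\cup\{\infty\}$ denotes the number of expressions $\alpha = a_j\beta^j + \dots + a_1\beta + a_0$ with $j, a_i \in \mathbb{Z}_{\geq 0}$ and $a_j \neq 0$; equivalently, the number of polynomials $f(x) \in \mathbb{Z}_{\geq 0}[x]$ with $f(\beta) = \alpha$. -}

module Defs where

open import Data.Nat as ℕ using (ℕ)
open import Data.Integer as ℤ using (ℤ; +_; ∣_∣)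
open import Data.Rational.Unnormalised as ℚ using (ℚᵘ; mkℚᵘ; _≃_)
open import Data.List using (List; []; _∷_)
open import Data.Product using (Σ; _×_; ∃; ∃-syntax; _,_)
open import Relation.Nullary using (¬_)
open import Data.Empty using (⊥)
open import Data.Integer.Divisibility using (_∣_)
open import Relation.Binary.PropositionalEquality using (_≡_)

-- Irreducibility of A x² + B x + C (A ≠ 0) in ℤ[x], spelled out for degree 2:
-- a factorisation into two non-units is either a product of two linear
-- integer polynomials (a x + b)(c x + d), or a constant non-unit k (|k| > 1)
-- times a quadratic, i.e. k divides all of A, B, C.
IrreducibleQuad : ℤ → ℤ → ℤ → Set
IrreducibleQuad A B C =
  ¬ (Σ ℤ λ a → Σ ℤ λ b → Σ ℤ λ c → Σ ℤ λ d →
       ¬ (a ≡ + 0) × ¬ (c ≡ + 0) ×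
       (a ℤ.* c ≡ A) × (a ℤ.* d ℤ.+ b ℤ.* c ≡ B) × (b ℤ.* d ≡ C))
  × ¬ (Σ ℤ λ k → (1 ℕ.< ∣ k ∣) × (k ∣ A) × (k ∣ B) × (k ∣ C))

disc : ℤ → ℤ → ℤ → ℤ
disc A B C = B ℤ.* B ℤ.- (+ 4) ℤ.* A ℤ.* C

-- The field ℚ(√D): a pair (x , y) of rationals stands for x + y √D.
-- (Both roots of A x² + B x + C lie in ℚ(√D) for D = disc A B C; when D > 0
-- is not a perfect square, this is a subfield of ℝ and x + y√D = x' + y'√D
-- iff x = x' and y = y'.)
QD : Set
QD = ℚᵘ × ℚᵘ

fromℤ : ℤ → ℚᵘ
fromℤ z = mkℚᵘ z 0

module _ (D : ℤ) where
  infixl 6 _⊕_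
  infixl 7 _⊗_
  _⊕_ : QD → QD → QD
  (x , y) ⊕ (x' , y') = (x ℚ.+ x' , y ℚ.+ y')

  _⊗_ : QD → QD → QD
  (x , y) ⊗ (x' , y') = (x ℚ.* x' ℚ.+ fromℤ D ℚ.* (y ℚ.* y') , x ℚ.* y' ℚ.+ y ℚ.* x')

  embℤ : ℤ → QD
  embℤ z = (fromℤ z , fromℤ (+ 0))

  _≈_ : QD → QD → Set
  (x , y) ≈ (x' , y') = (x ≃ x') × (y ≃ y')

  -- evaluation of a polynomial with ℕ-coefficients, given as the list
  -- a₀ ∷ a₁ ∷ … ∷ a_j ∷ [] (constant term first), at β (Horner scheme)
  eval : List ℕ → QD → QD
  eval []       β = embℤ (+ 0)
  eval (a ∷ as) β = embℤ (+ a) ⊕ β ⊗ eval as β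

LeadingNonzero : List ℕ → Set
LeadingNonzero []           = ⊥
LeadingNonzero (a ∷ [])     = ¬ (a ≡ 0)
LeadingNonzero (a ∷ b ∷ as) = LeadingNonzero (b ∷ as)

IsRoot : ℤ → ℤ → ℤ → QD → Set
IsRoot A B C β =
  _≈_ D (_⊕_ D (_⊕_ D (_⊗_ D (embℤ D A) (_⊗_ D β β)) (_⊗_ D (embℤ D B) β)) (embℤ D C))
        (embℤ D (+ 0))
  where D = disc A B C

{-# OPTIONS --safe #-}
-- Put a = A, b = −B, c = C, so that aβ² − bβ + c = 0, and e = 2a − b ≥ 0, s = a − b + c ≥ 1.
-- By the root equation, φ = aβ + a − b satisfies φ = s + βφ, hence jφ = js + β(jφ).
-- The polynomials L₀ = a, L_{j+1} = (e + js) + x L_j have coefficients in ℤ≥0 and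
-- L_j(β) = a + jφ; lowering the constant term e + bs of L_{b+1} by a (possible as s ≥ 1)
-- gives Q ∈ ℤ≥0[x] with Q(β) = (b+1)φ = k + βQ(β), k = (b+1)s. So the digit k can be
-- prepended to Q any number of times: k + kx + ⋯ + kxⁿ⁻¹ + xⁿQ(x), n ∈ ℕ, all evaluate
-- to α = Q(β). Only the ring structure of ℚ(√D) is used.
module Submission where

open import Algebra.Bundles using (CommutativeRing; AbelianGroup)
open import Algebra.Structures using (IsCommutativeRing)
import Algebra.Consequences.Setoid as Consequences
open import Algebra.Construct.DirectProduct using (abelianGroup)
import Algebra.Properties.CommutativeMonoid.Mult as CommutativeMonoidMult
import Algebra.Properties.Group as GroupProperties
import Algebra.Properties.Semiring.Mult as SemiringMult
import Algebra.Solver.Ring.NaturalCoefficients.Default as NaturalCoefficientSolver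
open import Data.List using (List; []; _∷_; _++_; replicate; length)
open import Data.List.Properties using (length-++; length-replicate)
open import Data.Nat as ℕ using (ℕ; zero; suc)
import Data.Nat.Properties as NP
open import Data.Nat.Tactic.RingSolver using (solve-∀)
open import Data.Product using (Σ; _×_; _,_)
import Data.Rational.Unnormalised as ℚ
import Data.Rational.Unnormalised.Properties as ℚP
open import Function.Definitions using (Injective)
open import Relation.Binary.PropositionalEquality as ≡ using (_≡_)
import Relation.Binary.Reasoning.Setoid as SetoidReasoning
open import Relation.Nullary using (¬_)

module QuadraticExtension {c ℓ} (R : CommutativeRing c ℓ) (d : CommutativeRing.Carrier R) where
  private
    module R = CommutativeRing R
    module G = AbelianGroup (abelianGroup R.+-abelianGroup R.+-abelianGroup)
  open NaturalCoefficientSolver R.commutativeSemiring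

  infixl 7 _*_
  _*_ : G.Carrier → G.Carrier → G.Carrier
  (x , y) * (x' , y') = (x R.* x' R.+ d R.* (y R.* y') , x R.* y' R.+ y R.* x')

  1# : G.Carrier
  1# = (R.1# , R.0#)

  *-cong : ∀ {p p' q q'} → p G.≈ p' → q G.≈ q' → p * q G.≈ p' * q'
  *-cong (x≈ , y≈) (x'≈ , y'≈) =
    R.+-cong (R.*-cong x≈ x'≈) (R.*-congˡ (R.*-cong y≈ y'≈)) ,
    R.+-cong (R.*-cong x≈ y'≈) (R.*-cong y≈ x'≈)

  *-assoc : ∀ p q r → (p * q) * r G.≈ p * (q * r)
  *-assoc (x , y) (x' , y') (x'' , y'') =
    solve 7 (λ x y x' y' x'' y'' d →
      (x :* x' :+ d :* (y :* y')) :* x'' :+ d :* ((x :* y' :+ y :* x') :* y'')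
      := x :* (x' :* x'' :+ d :* (y' :* y'')) :+ d :* (y :* (x' :* y'' :+ y' :* x'')))
      R.refl x y x' y' x'' y'' d ,
    solve 7 (λ x y x' y' x'' y'' d →
      (x :* x' :+ d :* (y :* y')) :* y'' :+ (x :* y' :+ y :* x') :* x''
      := x :* (x' :* y'' :+ y' :* x'') :+ y :* (x' :* x'' :+ d :* (y' :* y'')))
      R.refl x y x' y' x'' y'' d

  *-comm : ∀ p q → p * q G.≈ q * p
  *-comm (x , y) (x' , y') =
    solve 5 (λ x y x' y' d → x :* x' :+ d :* (y :* y') := x' :* x :+ d :* (y' :* y))
      R.refl x y x' y' d ,
    solve 4 (λ x y x' y' → x :* y' :+ y :* x' := x' :* y :+ y' :* x) R.refl x y x' y'

  *-identityˡ : ∀ p → 1# * p G.≈ p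
  *-identityˡ (x , y) =
    R.trans (R.+-cong (R.*-identityˡ x) (R.trans (R.*-congˡ (R.zeroˡ y)) (R.zeroʳ d)))
            (R.+-identityʳ x) ,
    R.trans (R.+-cong (R.*-identityˡ y) (R.zeroˡ x)) (R.+-identityʳ y)

  *-distribˡ-+ : ∀ p q r → p * (q G.∙ r) G.≈ (p * q) G.∙ (p * r)
  *-distribˡ-+ (x , y) (x' , y') (x'' , y'') =
    solve 7 (λ x y x' y' x'' y'' d →
      x :* (x' :+ x'') :+ d :* (y :* (y' :+ y''))
      := (x :* x' :+ d :* (y :* y')) :+ (x :* x'' :+ d :* (y :* y'')))
      R.refl x y x' y' x'' y'' d ,
    solve 6 (λ x y x' y' x'' y'' →
      x :* (y' :+ y'') :+ y :* (x' :+ x'')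
      := (x :* y' :+ y :* x') :+ (x :* y'' :+ y :* x''))
      R.refl x y x' y' x'' y''

  isCommutativeRing : IsCommutativeRing G._≈_ G._∙_ _*_ G._⁻¹ G.ε 1#
  isCommutativeRing = record
    { isRing = record
      { +-isAbelianGroup = G.isAbelianGroup
      ; *-cong = *-cong
      ; *-assoc = *-assoc
      ; *-identity = comm∧idˡ⇒id *-comm *-identityˡ
      ; distrib = comm∧distrˡ⇒distr G.∙-cong *-comm *-distribˡ-+
      }
    ; *-comm = *-comm
    }
    where open Consequences G.setoid

  commutativeRing : CommutativeRing c ℓ
  commutativeRing = record { isCommutativeRing = isCommutativeRing }

-- ladder a e s j is the coefficient list (constant term first) of a xʲ + Σ_{i<j} (e + i s) x^(j-1-i)
ladder : (a e s : ℕ) → ℕ → List ℕ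
ladder a e s zero    = a ∷ []
ladder a e s (suc j) = e ℕ.+ j ℕ.* s ∷ ladder a e s j

module Horner {c ℓ} (R : CommutativeRing c ℓ) (ι : ℕ → CommutativeRing.Carrier R)
  (β : CommutativeRing.Carrier R) where
  open CommutativeRing R
  open SemiringMult semiring using (×-congʳ; ×-comm-*) renaming (_×_ to _·_)
  open CommutativeMonoidMult +-commutativeMonoid using (×-distrib-+)
  open GroupProperties +-group using (∙-cancelʳ; //-rightDividesˡ)
  open NaturalCoefficientSolver commutativeSemiring
  open SetoidReasoning setoid

  horner : List ℕ → Carrier
  horner []       = 0#
  horner (x ∷ xs) = ι x + β * horner xs

  horner-replicate-++ : ∀ {k q} → horner (k ∷ q) ≈ horner q →
                        ∀ n → horner (replicate n k ++ q) ≈ horner q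
  horner-replicate-++ absorbs zero    = refl
  horner-replicate-++ absorbs (suc n) =
    trans (+-congˡ (*-congˡ (horner-replicate-++ absorbs n))) absorbs

  module _ (ι-0 : ι 0 ≈ 0#) (ι-+ : ∀ m n → ι (m ℕ.+ n) ≈ ι m + ι n) where

    ι-+-≡ : ∀ {m n p q} → m ℕ.+ n ≡ p ℕ.+ q → ι m + ι n ≈ ι p + ι q
    ι-+-≡ {m} {n} {p} {q} eq = trans (sym (ι-+ m n)) (trans (reflexive (≡.cong ι eq)) (ι-+ p q))

    ι-*-· : ∀ j m → ι (j ℕ.* m) ≈ j · ι m
    ι-*-· zero    m = ι-0
    ι-*-· (suc j) m = trans (ι-+ m (j ℕ.* m)) (+-congˡ (ι-*-· j m))

    module Ladder (a b c e s : ℕ) (e+b≡a+a : e ℕ.+ b ≡ a ℕ.+ a) (s+b≡a+c : s ℕ.+ b ≡ a ℕ.+ c)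
      (root : ι a * (β * β) + - ι b * β + ι c ≈ 0#) where

      φ : Carrier
      φ = ι a * β + ι a - ι b

      φ+b≈aβ+a : φ + ι b ≈ ι a * β + ι a
      φ+b≈aβ+a = //-rightDividesˡ (ι b) (ι a * β + ι a)

      aβ²+c≈bβ : ι a * (β * β) + ι c ≈ ι b * β
      aβ²+c≈bβ = begin
        ι a * (β * β) + ι c                       ≈⟨ +-identityʳ _ ⟨
        ι a * (β * β) + ι c + 0#                  ≈⟨ +-congˡ (trans (*-congʳ (-‿inverseˡ (ι b))) (zeroˡ β)) ⟨
        ι a * (β * β) + ι c + (- ι b + ι b) * β   ≈⟨ solve 5 (λ A B N C x →
                                                       A :* (x :* x) :+ C :+ (N :+ B) :* x
                                                       := A :* (x :* x) :+ N :* x :+ C :+ B :* x)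
                                                       refl (ι a) (ι b) (- ι b) (ι c) β ⟩
        ι a * (β * β) + - ι b * β + ι c + ι b * β ≈⟨ +-congʳ root ⟩
        0# + ι b * β                              ≈⟨ +-identityˡ _ ⟩
        ι b * β                                   ∎

      ι+aβ≈ι+φ : ∀ {x y} → x ℕ.+ b ≡ y ℕ.+ a → ι x + ι a * β ≈ ι y + φ
      ι+aβ≈ι+φ {x} {y} x+b≡y+a = ∙-cancelʳ (ι b) _ _ (begin
        ι x + ι a * β + ι b     ≈⟨ solve 4 (λ X A B x → X :+ A :* x :+ B := X :+ B :+ A :* x)
                                     refl (ι x) (ι a) (ι b) β ⟩
        ι x + ι b + ι a * β     ≈⟨ +-congʳ (ι-+-≡ x+b≡y+a) ⟩
        ι y + ι a + ι a * β     ≈⟨ solve 3 (λ Y A x → Y :+ A :+ A :* x := Y :+ (A :* x :+ A))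
                                     refl (ι y) (ι a) β ⟩
        ι y + (ι a * β + ι a)   ≈⟨ +-congˡ φ+b≈aβ+a ⟨
        ι y + (φ + ι b)         ≈⟨ +-assoc _ _ _ ⟨
        ι y + φ + ι b           ∎)

      φ-fixed : ι s + β * φ ≈ φ
      φ-fixed = ∙-cancelʳ (ι b * β + ι b) _ _ (begin
        ι s + β * φ + (ι b * β + ι b)          ≈⟨ solve 4 (λ S B x P →
                                                    S :+ x :* P :+ (B :* x :+ B) := S :+ B :+ x :* (P :+ B))
                                                    refl (ι s) (ι b) β φ ⟩
        ι s + ι b + β * (φ + ι b)              ≈⟨ +-cong (ι-+-≡ s+b≡a+c) (*-congˡ φ+b≈aβ+a) ⟩
        ι a + ι c + β * (ι a * β + ι a)        ≈⟨ solve 3 (λ A C x →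
                                                    A :+ C :+ x :* (A :* x :+ A) := A :* x :+ A :+ (A :* (x :* x) :+ C))
                                                    refl (ι a) (ι c) β ⟩
        ι a * β + ι a + (ι a * (β * β) + ι c)  ≈⟨ +-congˡ aβ²+c≈bβ ⟩
        ι a * β + ι a + ι b * β                ≈⟨ +-congʳ φ+b≈aβ+a ⟨
        φ + ι b + ι b * β                      ≈⟨ solve 3 (λ P B x → P :+ B :+ B :* x := P :+ (B :* x :+ B))
                                                    refl φ (ι b) β ⟩
        φ + (ι b * β + ι b)                    ∎)

      ·φ-fixed : ∀ j → ι (j ℕ.* s) + β * (j · φ) ≈ j · φ
      ·φ-fixed j = begin
        ι (j ℕ.* s) + β * (j · φ)   ≈⟨ +-cong (ι-*-· j s) (×-comm-* j β φ) ⟩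
        j · ι s + j · (β * φ)       ≈⟨ ×-distrib-+ (ι s) (β * φ) j ⟨
        j · (ι s + β * φ)           ≈⟨ ×-congʳ j φ-fixed ⟩
        j · φ                       ∎

      horner-ladder : ∀ j → horner (ladder a e s j) ≈ ι a + j · φ
      horner-ladder zero    = +-congˡ (zeroʳ β)
      horner-ladder (suc j) = begin
        ι (e ℕ.+ j ℕ.* s) + β * horner (ladder a e s j)   ≈⟨ +-cong (ι-+ e (j ℕ.* s)) (*-congˡ (horner-ladder j)) ⟩
        ι e + ι (j ℕ.* s) + β * (ι a + j · φ)             ≈⟨ solve 5 (λ E J x A P →
                                                               E :+ J :+ x :* (A :+ P) := E :+ A :* x :+ (J :+ x :* P))
                                                               refl (ι e) (ι (j ℕ.* s)) β (ι a) (j · φ) ⟩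
        ι e + ι a * β + (ι (j ℕ.* s) + β * (j · φ))       ≈⟨ +-cong (ι+aβ≈ι+φ e+b≡a+a) (·φ-fixed j) ⟩
        ι a + φ + j · φ                                   ≈⟨ +-assoc _ _ _ ⟩
        ι a + suc j · φ                                   ∎

      horner-∷-ladder : ∀ {q} j → q ℕ.+ b ≡ j ℕ.* s ℕ.+ a → horner (q ∷ ladder a e s j) ≈ suc j · φ
      horner-∷-ladder {q} j q+b≡js+a = begin
        ι q + β * horner (ladder a e s j)   ≈⟨ +-congˡ (*-congˡ (horner-ladder j)) ⟩
        ι q + β * (ι a + j · φ)             ≈⟨ solve 4 (λ Q x A P → Q :+ x :* (A :+ P) := Q :+ A :* x :+ x :* P)
                                                 refl (ι q) β (ι a) (j · φ) ⟩
        ι q + ι a * β + β * (j · φ)         ≈⟨ +-congʳ (ι+aβ≈ι+φ q+b≡js+a) ⟩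
        ι (j ℕ.* s) + φ + β * (j · φ)       ≈⟨ solve 3 (λ J P Q → J :+ P :+ Q := P :+ (J :+ Q))
                                                 refl (ι (j ℕ.* s)) φ (β * (j · φ)) ⟩
        φ + (ι (j ℕ.* s) + β * (j · φ))     ≈⟨ +-congˡ (·φ-fixed j) ⟩
        φ + j · φ                           ∎

      horner-∷-∷-ladder : ∀ {q} j → q ℕ.+ b ≡ j ℕ.* s ℕ.+ a →
                          horner (suc j ℕ.* s ∷ q ∷ ladder a e s j) ≈ horner (q ∷ ladder a e s j)
      horner-∷-∷-ladder j q+b≡js+a = begin
        ι (suc j ℕ.* s) + β * horner (_ ∷ ladder a e s j) ≈⟨ +-congˡ (*-congˡ (horner-∷-ladder j q+b≡js+a)) ⟩
        ι (suc j ℕ.* s) + β * (suc j · φ)                ≈⟨ ·φ-fixed (suc j) ⟩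
        suc j · φ                                        ≈⟨ horner-∷-ladder j q+b≡js+a ⟨
        horner (_ ∷ ladder a e s j)                      ∎

open import Defs
open import Data.Integer as Z using (ℤ; +_; -[1+_]; _+_; _*_; _<_; _≤_; _⊖_)
import Data.Integer.Properties as ZP

LeadingNonzero-∷ : ∀ x ys → LeadingNonzero ys → LeadingNonzero (x ∷ ys)
LeadingNonzero-∷ x []      ()
LeadingNonzero-∷ x (_ ∷ _) lnz = lnz

LeadingNonzero-++ : ∀ xs ys → LeadingNonzero ys → LeadingNonzero (xs ++ ys)
LeadingNonzero-++ []       ys lnz = lnz
LeadingNonzero-++ (x ∷ xs) ys lnz = LeadingNonzero-∷ x (xs ++ ys) (LeadingNonzero-++ xs ys lnz)

LeadingNonzero-ladder : ∀ {a} e s → ¬ a ≡ 0 → ∀ j → LeadingNonzero (ladder a e s j)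
LeadingNonzero-ladder e s a≢0 zero    = a≢0
LeadingNonzero-ladder e s a≢0 (suc j) = LeadingNonzero-∷ _ (ladder _ e s j) (LeadingNonzero-ladder e s a≢0 j)

replicate-++-injective : ∀ (k : ℕ) q → Injective _≡_ _≡_ (λ n → replicate n k ++ q)
replicate-++-injective k q {m} {n} eq = NP.+-cancelʳ-≡ (length q) m n (begin
  m ℕ.+ length q                       ≡⟨ ≡.cong (ℕ._+ length q) (length-replicate m) ⟨
  length (replicate m k) ℕ.+ length q  ≡⟨ length-++ (replicate m k) ⟨
  length (replicate m k ++ q)          ≡⟨ ≡.cong length eq ⟩
  length (replicate n k ++ q)          ≡⟨ length-++ (replicate n k) ⟩
  length (replicate n k) ℕ.+ length q  ≡⟨ ≡.cong (ℕ._+ length q) (length-replicate n) ⟩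
  n ℕ.+ length q                       ∎)
  where open ≡.≡-Reasoning

fromℤ-+ : ∀ i j → fromℤ (i + j) ℚ.≃ fromℤ i ℚ.+ fromℤ j
fromℤ-+ i j = ℚ.*≡* (≡.trans (ZP.*-identityʳ (i + j))
  (≡.sym (≡.trans (ZP.*-identityʳ _) (≡.cong₂ _+_ (ZP.*-identityʳ i) (ZP.*-identityʳ j)))))

HasValueWithInfinitelyManyExpansions : ℤ → QD → Set
HasValueWithInfinitelyManyExpansions D β =
  Σ QD λ α → Σ (ℕ → List ℕ) λ f → Injective _≡_ _≡_ f ×
    ((n : ℕ) → LeadingNonzero (f n) × _≈_ D (eval D (f n) β) α)

module QuadraticField (D : ℤ) where
  open QuadraticExtension ℚP.+-*-commutativeRing (fromℤ D) public using (commutativeRing)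
  open CommutativeRing commutativeRing using (0#) renaming (_≈_ to _≈ᴰ_; _+_ to _+ᴰ_)

  ι : ℕ → QD
  ι n = embℤ D (+ n)

  ι-0 : ι 0 ≈ᴰ 0#
  ι-0 = ℚP.≃-refl , ℚP.≃-refl

  ι-+ : ∀ m n → ι (m ℕ.+ n) ≈ᴰ ι m +ᴰ ι n
  ι-+ m n = fromℤ-+ (+ m) (+ n) , fromℤ-+ (+ 0) (+ 0)

  module _ (β : QD) where
    open Horner commutativeRing ι β using (horner; horner-replicate-++)

    eval≡horner : ∀ xs → eval D xs β ≡ horner xs
    eval≡horner []       = ≡.refl
    eval≡horner (x ∷ xs) = ≡.cong (λ v → _⊕_ D (ι x) (_⊗_ D β v)) (eval≡horner xs)

    infinitelyManyExpansions : ∀ k q → LeadingNonzero q → horner (k ∷ q) ≈ᴰ horner q →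
                               HasValueWithInfinitelyManyExpansions D β
    infinitelyManyExpansions k q q-leading absorbs =
      eval D q β , (λ n → replicate n k ++ q) , replicate-++-injective k q ,
      λ n → LeadingNonzero-++ (replicate n k) q q-leading ,
            ≡.subst₂ (_≈_ D) (≡.sym (eval≡horner (replicate n k ++ q))) (≡.sym (eval≡horner q))
              (horner-replicate-++ absorbs n)

positive-⊖ : ∀ m n → + 0 < m ⊖ n → Σ ℕ λ k → suc k ℕ.+ n ≡ m
positive-⊖ zero    zero    (Z.+<+ ())
positive-⊖ (suc m) zero    _ = m , ≡.cong suc (NP.+-identityʳ m)
positive-⊖ (suc m) (suc n) 0<m⊖n
  with k , k+n≡m ← positive-⊖ m n (≡.subst (+ 0 <_) (ZP.[1+m]⊖[1+n]≡m⊖n m n) 0<m⊖n)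
  = k , ≡.trans (NP.+-suc (suc k) n) (≡.cong suc k+n≡m)

expansions-of-root : ∀ a b c e s' → e ℕ.+ b ≡ a ℕ.+ a → suc s' ℕ.+ b ≡ a ℕ.+ c → ¬ a ≡ 0 →
  (β : QD) → IsRoot (+ a) (Z.- + b) (+ c) β →
  HasValueWithInfinitelyManyExpansions (disc (+ a) (Z.- + b) (+ c)) β
expansions-of-root a b c e s' e+b≡a+a s+b≡a+c a≢0 β root =
  infinitelyManyExpansions β (suc b ℕ.* suc s') q q-leading (horner-∷-∷-ladder b q₀+b≡bs+a)
  where
  open QuadraticField (disc (+ a) (Z.- + b) (+ c))
  open Horner commutativeRing ι β
  open Ladder ι-0 ι-+ a b c e (suc s') e+b≡a+a s+b≡a+c root

  q₀ : ℕ
  q₀ = b ℕ.* s' ℕ.+ a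

  q₀+b≡bs+a : q₀ ℕ.+ b ≡ b ℕ.* suc s' ℕ.+ a
  q₀+b≡bs+a = rearrange a b s'
    where
    rearrange : ∀ a b s' → b ℕ.* s' ℕ.+ a ℕ.+ b ≡ b ℕ.* suc s' ℕ.+ a
    rearrange = solve-∀

  q : List ℕ
  q = q₀ ∷ ladder a e (suc s') b

  q-leading : LeadingNonzero q
  q-leading = LeadingNonzero-∷ q₀ (ladder a e (suc s') b) (LeadingNonzero-ladder e (suc s') a≢0 b)

lemma6 : (A B C : ℤ) → IrreducibleQuad A B C →
           (β : QD) →
           -- β is a root of A x² + B x + C ...
           IsRoot A B C β →
           -- ... and β is real
           + 0 ≤ disc A B C →
           + 0 < A → + 0 < C → B < + 0 → + 0 < (+ 2) * A + B → + 0 < A + B + C →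
           -- there is α with p_β(α) = ∞: infinitely many (injectively enumerated)
           -- polynomials f ∈ ℤ≥0[x] with nonzero leading coefficient and f(β) = α
           Σ QD λ α → Σ (ℕ → List ℕ) λ f → Injective _≡_ _≡_ f ×
             ((n : ℕ) → LeadingNonzero (f n) × _≈_ (disc A B C) (eval (disc A B C) (f n) β) α)
lemma6 (+ zero)   _         _        _ _ _ _ (Z.+<+ ()) _  _          _ _
lemma6 -[1+ _ ]   _         _        _ _ _ _ ()         _  _          _ _
lemma6 (+ suc _)  (+ _)     _        _ _ _ _ _          _  (Z.+<+ ()) _ _
lemma6 (+ suc _)  -[1+ _ ]  -[1+ _ ] _ _ _ _ _          () _          _ _
lemma6 (+ suc a') -[1+ b' ] (+ c)    _ β root _ _ _ _ 0<2A+B 0<A+B+C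
  with e' , e+b≡2a ← positive-⊖ (2 ℕ.* suc a') (suc b') 0<2A+B
     | s' , s+b≡a+c ← positive-⊖ (suc a' ℕ.+ c) (suc b')
                        (≡.subst (+ 0 <_) (ZP.distribˡ-⊖-+-pos c (suc a') (suc b')) 0<A+B+C)
  = expansions-of-root (suc a') (suc b') c (suc e') s'
      (≡.trans e+b≡2a (≡.cong (suc a' ℕ.+_) (NP.+-identityʳ (suc a')))) s+b≡a+c (λ ()) β root
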